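{- Let $\Gamma,\Gamma'$ be pure graphs, $v_0\in V(\Gamma)$, $v_0'\in V(\Gamma')$, and $f\colon\mathbf{QD}_{v_0}(\Gamma)\to\mathbf{QD}_{v_0'}(\Gamma')$ an isomorphism of posets. Let $e_1,e_2$ be parallel edges of $\Gamma$ with end-vertices $s,t$, let $D\in\mathbf{QD}_{v_0}(\Gamma,\{e_1,e_2\})$, and let $e_1',e_2'$ be parallel edges of $\Gamma'$ with end-vertices $s',t'$ and $D'\in\mathbf{QD}_{v_0'}(\Gamma',\{e_1',e_2'\})$ be such that $f(\mathbf R_{e_1,e_2}(D))=\mathbf R_{e_1',e_2'}(D')$. Assume that $f(\{e_1\},D-v_{e_2}+s)=(\{e_1'\},D'-v_{e_2'}+s')$ and $f(\{e_1\},D-v_{e_2}+t)=(\{e_2'\},D'-v_{e_1'}+t')$. Then $\{e_1,e_2\}$ is a special pair of $\Gamma$ and $\{e_1',e_2'\}$ is a special pair of $\Gamma'$.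
   Context: Graphs are finite, loops and multiple edges allowed; pure means all weights are 0, genus $g=b_1(\Gamma)$; $\mathrm{val}(v)$ counts loops twice. Two edges are parallel if there are two vertices each incident to both. For $\mathcal E\subset E(\Gamma)$, $\Gamma^{\mathcal E}$ is obtained by inserting one vertex $v_e$ in each $e\in\mathcal E$. A pseudo-divisor is $(\mathcal E,D)$ with $D\colon V(\Gamma^{\mathcal E})\to\mathbb Z$, $D(v_e)=1$ for $e\in\mathcal E$; for $e\in\mathcal E$, $D-v_e+s$ is the divisor on $\Gamma^{\mathcal E\setminus\{e\}}$ obtained by deleting $v_e$ and adding 1 at $s$. Order: $(\mathcal E,D)\ge(\mathcal E',D')$ iff $\mathcal E'\subset\mathcal E$ and there is $\varphi\colon\mathcal E\setminus\mathcal E'\to V(\Gamma)$, $\varphi(e)$ an end-vertex of $e$, with $D'(v)=D(v)+|\varphi^{ -1}(v)|$ for $v\in V(\Gamma)$. With $\mu(v)=-1+\mathrm{val}(v)/2$ on $V(\Gamma)$ and $0$ on exceptional vertices, $(\mathcal E,D)$ of degree $g-1$ is $v_0$-quasistable if $D(V)-\mu(V)+\delta_V/2\ge0$ for all nonempty $V\subset V(\Gamma^{\mathcal E})$, strictly when $v_0\notin V$ ($\delta_V$ = number of edges of $\Gamma^{\mathcal E}$ between $V$ and its complement). $\mathbf{QD}_{v_0}(\Gamma)$ is the poset of these; $\mathbf{QD}_{v_0}(\Gamma,\mathcal E)=\{D:(\mathcal E,D)\in\mathbf{QD}_{v_0}(\Gamma)\}$. For parallel $e_1,e_2$ with end-vertices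 $s,t$ and $D\in\mathbf{QD}_{v_0}(\Gamma,\{e_1,e_2\})$, $\mathbf R_{e_1,e_2}(D)$ is the subposet consisting of $(\{e_1,e_2\},D)$, $(\{e_1\},D-v_{e_2}+s)$, $(\{e_1\},D-v_{e_2}+t)$, $(\{e_2\},D-v_{e_1}+s)$, $(\{e_2\},D-v_{e_1}+t)$, $(\emptyset,D-v_{e_1}-v_{e_2}+2s)$, $(\emptyset,D-v_{e_1}-v_{e_2}+s+t)$, $(\emptyset,D-v_{e_1}-v_{e_2}+2t)$. A special pair of $\Gamma$ is a set $\{e_1,e_2\}$ of two distinct parallel edges such that no other edge of $\Gamma$ is parallel to them and $\Gamma$ remains connected after removing $e_1$ and $e_2$. -}

module Defs where

open import Data.Nat using (ℕ; zero; suc)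
open import Data.Integer using (ℤ; +_; _+_; _-_; _*_; _≤_; _<_; 0ℤ; 1ℤ)
open import Data.Fin using (Fin; zero; suc; _≟_)
open import Data.Bool using (Bool; true; false; _∧_; _∨_; not; _xor_)
open import Data.Vec using (Vec; lookup; _[_]≔_; updateAt; tabulate)
open import Data.Product using (Σ; ∃; _×_; _,_)
open import Data.Sum using (_⊎_)
open import Data.Unit using (⊤)
open import Data.List using (List; []; _∷_)
open import Data.List.Membership.Propositional using (_∈_)
open import Relation.Binary.PropositionalEquality using (_≡_; _≢_)
open import Relation.Nullary using (¬_)
open import Relation.Nullary.Decidable using (⌊_⌋)

-- Finite graphs (loops and multiple edges allowed), pure (no weights).
-- Vertices Fin nV, edges Fin nE; edge e has end-vertices src e, tgt e
-- (orientation is irrelevant everywhere below).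

record Graph : Set where
  field
    nV nE : ℕ
    src tgt : Fin nE → Fin nV
open Graph public

∑ : ∀ {k} → (Fin k → ℤ) → ℤ
∑ {zero} f = 0ℤ
∑ {suc k} f = f zero + ∑ (λ i → f (suc i))

[_] : Bool → ℤ
[ true ] = 1ℤ
[ false ] = 0ℤ

module _ (Γ : Graph) where

  Inc : Fin (nV Γ) → Fin (nE Γ) → Set
  Inc u e = (u ≡ src Γ e) ⊎ (u ≡ tgt Γ e)

  Parallel : Fin (nE Γ) → Fin (nE Γ) → Set
  Parallel e f = Σ (Fin (nV Γ)) λ u → Σ (Fin (nV Γ)) λ w →
    u ≢ w × Inc u e × Inc u f × Inc w e × Inc w f

  Ends : Fin (nE Γ) → Fin (nV Γ) → Fin (nV Γ) → Set
  Ends e s t = (src Γ e ≡ s × tgt Γ e ≡ t) ⊎ (src Γ e ≡ t × tgt Γ e ≡ s)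

  data Reach (A : Fin (nE Γ) → Set) (u : Fin (nV Γ)) : Fin (nV Γ) → Set where
    here : Reach A u u
    fwd  : ∀ e → A e → Reach A u (src Γ e) → Reach A u (tgt Γ e)
    bwd  : ∀ e → A e → Reach A u (tgt Γ e) → Reach A u (src Γ e)

  ConnectedUsing : (Fin (nE Γ) → Set) → Set
  ConnectedUsing A = ∀ u w → Reach A u w

  Connected : Set
  Connected = ConnectedUsing (λ _ → ⊤)

  genus : ℤ
  genus = (+ nE Γ) - (+ nV Γ) + 1ℤ

  -- valence (loops counted twice) and 2μ(v) = val(v) - 2
  val : Fin (nV Γ) → ℤ
  val v = ∑ λ e → [ ⌊ src Γ e ≟ v ⌋ ] + [ ⌊ tgt Γ e ≟ v ⌋ ]

  twiceμ : Fin (nV Γ) → ℤ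
  twiceμ v = val v - (+ 2)

  -- pseudo-divisor (ℰ , D): ℰ ⊆ E(Γ) as a Bool vector, D given on V(Γ);
  -- on the exceptional vertices v_e (e ∈ ℰ) D is 1 by definition.
  record PD : Set where
    constructor pd
    field
      Ex : Vec Bool (nE Γ)
      Dv : Vec ℤ (nV Γ)

  deg : PD → ℤ
  deg (pd E D) = ∑ (lookup D) + ∑ (λ e → [ lookup E e ])

  -- a subset V ⊆ V(Γ^ℰ) is a pair (S , T): S ⊆ V(Γ), T ⊆ ℰ (exceptional vertices)
  -- δ_V : number of edges of Γ^ℰ joining V and its complement
  δ : Vec Bool (nE Γ) → (Fin (nV Γ) → Bool) → (Fin (nE Γ) → Bool) → ℤ
  δ E S T = ∑ λ e → edgeContrib (lookup E e) e
    where
    edgeContrib : Bool → Fin (nE Γ) → ℤ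
    edgeContrib true  e = [ S (src Γ e) xor T e ] + [ S (tgt Γ e) xor T e ]
    edgeContrib false e = [ S (src Γ e) xor S (tgt Γ e) ]

  -- v₀-quasistable of degree g - 1; the inequality
  -- D(V) - μ(V) + δ_V/2 ≥ 0 is multiplied by 2
  Quasistable : Fin (nV Γ) → PD → Set
  Quasistable v₀ (pd E D) =
    (deg (pd E D) ≡ genus - 1ℤ) ×
    (∀ (S : Fin (nV Γ) → Bool) (T : Fin (nE Γ) → Bool) →
       (∀ e → T e ≡ true → lookup E e ≡ true) →
       ((Σ (Fin (nV Γ)) λ v → S v ≡ true) ⊎ (Σ (Fin (nE Γ)) λ e → T e ≡ true)) →
       let q = (+ 2) * (∑ (λ v → if' (S v) (lookup D v)) + ∑ (λ e → [ T e ]))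
               - ∑ (λ v → if' (S v) (twiceμ v)) + δ E S T
       in (S v₀ ≡ true → 0ℤ ≤ q) × (S v₀ ≡ false → 0ℤ < q))
    where
    if' : Bool → ℤ → ℤ
    if' true z = z
    if' false _ = 0ℤ

  _≽_ : PD → PD → Set
  pd E D ≽ pd E' D' =
    (∀ e → lookup E' e ≡ true → lookup E e ≡ true) ×
    (Σ (Fin (nE Γ) → Fin (nV Γ)) λ φ →
       (∀ e → removed e ≡ true → Inc (φ e) e) ×
       (∀ v → lookup D' v ≡ lookup D v + ∑ (λ e → [ removed e ∧ ⌊ φ e ≟ v ⌋ ])))
    where
    removed : Fin (nE Γ) → Bool
    removed e = lookup E e ∧ not (lookup E' e)

  _-v[_]+_ : PD → Fin (nE Γ) → Fin (nV Γ) → PD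
  pd E D -v[ e ]+ s = pd (E [ e ]≔ false) (updateAt D s (λ z → z + 1ℤ))

  pairSet : Fin (nE Γ) → Fin (nE Γ) → Vec Bool (nE Γ)
  pairSet e₁ e₂ = tabulate λ e → ⌊ e ≟ e₁ ⌋ ∨ ⌊ e ≟ e₂ ⌋

  R : Fin (nE Γ) → Fin (nE Γ) → Fin (nV Γ) → Fin (nV Γ) → Vec ℤ (nV Γ) → List PD
  R e₁ e₂ s t D =
    x ∷ (x -v[ e₂ ]+ s) ∷ (x -v[ e₂ ]+ t) ∷ (x -v[ e₁ ]+ s) ∷ (x -v[ e₁ ]+ t)
      ∷ ((x -v[ e₁ ]+ s) -v[ e₂ ]+ s) ∷ ((x -v[ e₁ ]+ s) -v[ e₂ ]+ t)
      ∷ ((x -v[ e₁ ]+ t) -v[ e₂ ]+ t) ∷ []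
    where
    x = pd (pairSet e₁ e₂) D

  SpecialPair : Fin (nE Γ) → Fin (nE Γ) → Set
  SpecialPair e₁ e₂ =
    e₁ ≢ e₂ × Parallel e₁ e₂ ×
    (∀ e → e ≢ e₁ → e ≢ e₂ → ¬ Parallel e e₁ × ¬ Parallel e e₂) ×
    ConnectedUsing (λ e → e ≢ e₁ × e ≢ e₂)

record PosetIso (Γ : Graph) (v₀ : Fin (nV Γ)) (Γ' : Graph) (v₀' : Fin (nV Γ')) : Set where
  field
    fun : PD Γ → PD Γ'
    inv : PD Γ' → PD Γ
    fun-QD : ∀ x → Quasistable Γ v₀ x → Quasistable Γ' v₀' (fun x)
    inv-QD : ∀ y → Quasistable Γ' v₀' y → Quasistable Γ v₀ (inv y)
    inv-fun : ∀ x → Quasistable Γ v₀ x → inv (fun x) ≡ x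
    fun-inv : ∀ y → Quasistable Γ' v₀' y → fun (inv y) ≡ y
    mono : ∀ x y → Quasistable Γ v₀ x → Quasistable Γ v₀ y →
           (_≽_ Γ x y → _≽_ Γ' (fun x) (fun y)) × (_≽_ Γ' (fun x) (fun y) → _≽_ Γ x y)
open PosetIso public

-- f(𝓡) = 𝓡' for subsets of QD (given as lists, intersected with QD)
ImageEq : ∀ {Γ v₀ Γ' v₀'} → PosetIso Γ v₀ Γ' v₀' → List (PD Γ) → List (PD Γ') → Set
ImageEq {Γ} {v₀} {Γ'} {v₀'} f 𝓡 𝓡' =
  (∀ x → x ∈ 𝓡 → Quasistable Γ v₀ x → fun f x ∈ 𝓡') ×
  (∀ y → y ∈ 𝓡' → Quasistable Γ' v₀' y →
     Σ (PD Γ) λ x → x ∈ 𝓡 × Quasistable Γ v₀ x × fun f x ≡ y)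

-- f(x) = y  (x ∈ QD, so that f(x) is defined)
MapsTo : ∀ {Γ v₀ Γ' v₀'} → PosetIso Γ v₀ Γ' v₀' → PD Γ → PD Γ' → Set
MapsTo {Γ} {v₀} f x y = Quasistable Γ v₀ x × fun f x ≡ y

-- Quasistability alone makes Γ ∖ {e₁, e₂} connected: if a cut S were crossed only by e₁ and e₂, the
-- charges 2 (D(V) - μ(V) + δ_V / 2) of S and of its complement would add up to 2 (deg - (g - 1)) = 0,
-- although one of them is positive and the other non-negative.
--
-- Suppose a third edge e₃ joined s and t. Exchanging e₂ and e₃ is an automorphism of Γ, so ({e₁, e₃}, D)
-- is quasistable; it lies above D - v_{e₂} + s and D - v_{e₂} + t, so its image lies above
-- D′ - v_{e₂′} + s′ and D′ - v_{e₁′} + t′ and hence, exchanging e₁′ and e₂′, above D′ - v_{e₂′} + t′.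
-- Comparing edge sets and the values at s′ shows that the preimage of D′ - v_{e₂′} + t′ in R_{e₁,e₂}(D)
-- contains e₂, yet it lies below ({e₁, e₃}, D). A third edge in Γ′ is excluded in the same way,
-- running the argument backwards through f⁻¹.

module Submission where

open import Defs
open import Data.Integer using (ℤ)
open import Data.Fin using (Fin)
open import Data.Vec using (Vec)
open import Data.Product using (_×_)
open import Relation.Binary.PropositionalEquality using (_≢_)

open import Data.Bool using (Bool; true; false; not; _∧_; _∨_; _xor_; if_then_else_) renaming (_≟_ to _≟ᴮ_)
open import Data.Bool.Properties using (∧-inverseʳ; ∨-identityʳ; ∨-zeroʳ; not-¬; xor-comm)
open import Data.Empty using (⊥; ⊥-elim)
open import Data.Fin using (zero; suc; _≟_)
open import Data.Fin.Permutation using (Permutation′; _⟨$⟩ʳ_; _⟨$⟩ˡ_; inverseˡ; inverseʳ; transpose)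
import Data.Fin.Permutation.Components as PC
open import Data.Fin.Properties using (suc-injective)
open import Data.Integer using (+_; _+_; _-_; _*_; -_; _≤_; _<_; 0ℤ; 1ℤ; nonNegative; +≤+)
import Data.Integer.Properties as ℤ
open import Data.Integer.Tactic.RingSolver using (solve-∀)
open import Data.Nat using (ℕ; z≤n)
open import Data.List using (List; []; _∷_; allFin)
open import Data.List.Membership.Propositional using (_∈_)
open import Data.List.Membership.Propositional.Properties using (∈-allFin)
open import Data.List.Relation.Unary.Any using (here; there)
open import Data.Product using (Σ; ∃; _,_; proj₁; proj₂)
open import Data.Sum using (_⊎_; inj₁; inj₂)
import Data.Sum as Sum
open import Data.Vec using (lookup; updateAt; _[_]≔_)
open import Data.Vec.Properties using (lookup∘updateAt; lookup∘updateAt′; lookup∘update; lookup∘update′; lookup∘tabulate; []≔-commutes)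
import Data.Vec.Functional as VF
import Data.Vec.Functional.Properties as VF
open import Function using (_∘_; id)
open import Relation.Binary.PropositionalEquality using (_≡_; refl; sym; trans; cong; cong₂; subst; subst₂; _≗_; module ≡-Reasoning)
open import Relation.Nullary using (¬_; yes; no)
open import Relation.Nullary.Decidable using (⌊_⌋)
import Relation.Unary as U

open PD using (Ex; Dv)

import Algebra.Properties.CommutativeMonoid.Sum ℤ.+-0-commutativeMonoid as FinSum

∑≡sum : ∀ {n} (f : Fin n → ℤ) → ∑ f ≡ FinSum.sum f
∑≡sum {ℕ.zero} f = refl
∑≡sum {ℕ.suc n} f = cong (_+_ (f zero)) (∑≡sum (f ∘ suc))

∑-cong : ∀ {n} {f g : Fin n → ℤ} → f ≗ g → ∑ f ≡ ∑ g
∑-cong {ℕ.zero} f≗g = refl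
∑-cong {ℕ.suc n} f≗g = cong₂ _+_ (f≗g zero) (∑-cong (f≗g ∘ suc))

∑-distrib-+ : ∀ {n} (f g : Fin n → ℤ) → ∑ (λ i → f i + g i) ≡ ∑ f + ∑ g
∑-distrib-+ f g = begin
  ∑ (λ i → f i + g i)           ≡⟨ ∑≡sum (λ i → f i + g i) ⟩
  FinSum.sum (λ i → f i + g i)  ≡⟨ FinSum.∑-distrib-+ f g ⟩
  FinSum.sum f + FinSum.sum g   ≡⟨ sym (cong₂ _+_ (∑≡sum f) (∑≡sum g)) ⟩
  ∑ f + ∑ g                     ∎
  where open ≡-Reasoning

∑-comm : ∀ {m n} (f : Fin m → Fin n → ℤ) → ∑ (λ i → ∑ (f i)) ≡ ∑ (λ j → ∑ (λ i → f i j))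
∑-comm f = begin
  ∑ (λ i → ∑ (f i))                            ≡⟨ trans (∑-cong (∑≡sum ∘ f))
                                                        (∑≡sum (FinSum.sum ∘ f)) ⟩
  FinSum.sum (λ i → FinSum.sum (f i))          ≡⟨ FinSum.∑-comm f ⟩
  FinSum.sum (λ j → FinSum.sum (λ i → f i j))  ≡⟨ sym (trans (∑-cong (λ j → ∑≡sum (λ i → f i j)))
                                                                 (∑≡sum (λ j → FinSum.sum (λ i → f i j)))) ⟩
  ∑ (λ j → ∑ (λ i → f i j))                    ∎
  where open ≡-Reasoning

∑-permute : ∀ {n} (f : Fin n → ℤ) (π : Permutation′ n) → ∑ f ≡ ∑ (f ∘ (π ⟨$⟩ʳ_))
∑-permute f π = trans (∑≡sum f) (trans (FinSum.∑-permute f π) (sym (∑≡sum (f ∘ (π ⟨$⟩ʳ_)))))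

∑-const : ∀ {n} (c : ℤ) → ∑ {n} (λ _ → c) ≡ + n * c
∑-const {ℕ.zero} c = sym (ℤ.*-zeroˡ c)
∑-const {ℕ.suc n} c = trans (cong (_+_ c) (∑-const {n} c)) (sym (ℤ.suc-* (+ n) c))

∑-perturb : ∀ {n} {f g : Fin n → ℤ} (a : Fin n) {d : ℤ} →
            (∀ i → i ≢ a → f i ≡ g i) → f a ≡ g a + d → ∑ f ≡ ∑ g + d
∑-perturb {f = f} {g} zero {d} off at = begin
  f zero + ∑ (f ∘ suc)      ≡⟨ cong₂ _+_ at (∑-cong (λ i → off (suc i) λ ())) ⟩
  g zero + d + ∑ (g ∘ suc)  ≡⟨ reorder (g zero) d (∑ (g ∘ suc)) ⟩
  g zero + ∑ (g ∘ suc) + d  ∎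
  where
  open ≡-Reasoning
  reorder : ∀ x y z → x + y + z ≡ x + z + y
  reorder = solve-∀
∑-perturb {f = f} {g} (suc a) {d} off at =
  trans (cong₂ _+_ (off zero λ ()) (∑-perturb a (λ i i≢a → off (suc i) (i≢a ∘ suc-injective)) at))
        (sym (ℤ.+-assoc (g zero) (∑ (g ∘ suc)) d))

∑-zero : ∀ {n} → ∑ {n} (λ _ → 0ℤ) ≡ 0ℤ
∑-zero {n} = trans (∑-const {n} 0ℤ) (ℤ.*-zeroʳ (+ n))

∑-single : ∀ {n} {f : Fin n → ℤ} (a : Fin n) → (∀ i → i ≢ a → f i ≡ 0ℤ) → ∑ f ≡ f a
∑-single {n} {f} a off =
  trans (∑-perturb a off (sym (ℤ.+-identityˡ (f a)))) (trans (cong (_+ f a) (∑-zero {n})) (ℤ.+-identityˡ (f a)))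

∑-nonneg : ∀ {n} {f : Fin n → ℤ} → (∀ i → 0ℤ ≤ f i) → 0ℤ ≤ ∑ f
∑-nonneg {ℕ.zero} f≥0 = ℤ.≤-refl
∑-nonneg {ℕ.suc n} f≥0 = ℤ.+-mono-≤ (f≥0 zero) (∑-nonneg (f≥0 ∘ suc))

∑[_]_ : ∀ {n} → (Fin n → Bool) → (Fin n → ℤ) → ℤ
∑[ S ] f = ∑ (λ i → if S i then f i else 0ℤ)

∑[]-complement : ∀ {n} (S : Fin n → Bool) (f : Fin n → ℤ) → ∑[ S ] f + ∑[ not ∘ S ] f ≡ ∑ f
∑[]-complement S f =
  trans (sym (∑-distrib-+ (λ i → if S i then f i else 0ℤ) (λ i → if not (S i) then f i else 0ℤ)))
        (∑-cong (λ i → split (S i) (f i)))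
  where
  split : ∀ b z → (if b then z else 0ℤ) + (if not b then z else 0ℤ) ≡ z
  split true  z = ℤ.+-identityʳ z
  split false z = ℤ.+-identityˡ z

⌊≟⌋-refl : ∀ {n} (i : Fin n) → ⌊ i ≟ i ⌋ ≡ true
⌊≟⌋-refl i with i ≟ i
... | yes _   = refl
... | no i≢i = ⊥-elim (i≢i refl)

⌊≟⌋-≢ : ∀ {n} {i j : Fin n} → i ≢ j → ⌊ i ≟ j ⌋ ≡ false
⌊≟⌋-≢ {i = i} {j} i≢j with i ≟ j
... | yes i≡j = ⊥-elim (i≢j i≡j)
... | no _    = refl

transpose-elim : ∀ {n} {P : Fin n → Fin n → Set} {i j : Fin n} →
                 P i j → P j i → (∀ k → k ≢ i → k ≢ j → P k k) → ∀ k → P k (PC.transpose i j k)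
transpose-elim {i = i} {j} pij pji pkk k with k ≟ i
... | yes refl = pij
... | no k≢i with k ≟ j
...   | yes refl = pji
...   | no k≢j   = pkk k k≢i k≢j

∑-indicator : ∀ {n} (a : Fin n) → ∑ (λ v → [ ⌊ a ≟ v ⌋ ]) ≡ 1ℤ
∑-indicator a =
  trans (∑-single a (λ v v≢a → cong [_] (⌊≟⌋-≢ (v≢a ∘ sym)))) (cong [_] (⌊≟⌋-refl a))

module _ {Γ : Graph} {A : Fin (nE Γ) → Set} where

  Reach-trans : ∀ {u v w} → Reach Γ A u v → Reach Γ A v w → Reach Γ A u w
  Reach-trans r here          = r
  Reach-trans r (fwd e a r′) = fwd e a (Reach-trans r r′)
  Reach-trans r (bwd e a r′) = bwd e a (Reach-trans r r′)

  Reach-sym : ∀ {u w} → Reach Γ A u w → Reach Γ A w u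
  Reach-sym here        = here
  Reach-sym (fwd e a r) = Reach-trans (bwd e a here) (Reach-sym r)
  Reach-sym (bwd e a r) = Reach-trans (fwd e a here) (Reach-sym r)

  Reach-mono : ∀ {B : Fin (nE Γ) → Set} {u w} → (∀ e → A e → B e) → Reach Γ A u w → Reach Γ B u w
  Reach-mono A⊆B here        = here
  Reach-mono A⊆B (fwd e a r) = fwd e (A⊆B e a) (Reach-mono A⊆B r)
  Reach-mono A⊆B (bwd e a r) = bwd e (A⊆B e a) (Reach-mono A⊆B r)

module _ (Γ : Graph) {A : Fin (nE Γ) → Set} (A? : U.Decidable A) where

  record Labelling (L : List (Fin (nE Γ))) : Set where
    field
      label    : Fin (nV Γ) → Fin (nV Γ)
      constant : ∀ {e} → e ∈ L → A e → label (src Γ e) ≡ label (tgt Γ e)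
      sound    : ∀ {u w} → label u ≡ label w → Reach Γ A u w

  labelling : ∀ L → Labelling L
  labelling [] = record { label = id ; constant = λ () ; sound = λ { refl → here } }
  labelling (e ∷ L) with A? e
  ... | no ¬Ae = record
    { label    = label
    ; constant = λ { (here refl) Ae → ⊥-elim (¬Ae Ae) ; (there e∈L) → constant e∈L }
    ; sound    = sound
    }
    where open Labelling (labelling L)
  ... | yes Ae = record { label = merge ∘ label ; constant = constant′ ; sound = sound′ }
    where
    open Labelling (labelling L)
    ℓs ℓt : Fin (nV Γ)
    ℓs = label (src Γ e)
    ℓt = label (tgt Γ e)

    merge : Fin (nV Γ) → Fin (nV Γ)
    merge ℓ = if ⌊ ℓ ≟ ℓs ⌋ then ℓt else ℓ

    merge-ℓs : merge ℓs ≡ ℓt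
    merge-ℓs rewrite ⌊≟⌋-refl ℓs = refl

    merge-ℓt : merge ℓt ≡ ℓt
    merge-ℓt with ℓt ≟ ℓs
    ... | yes _ = refl
    ... | no _  = refl

    constant′ : ∀ {e′} → e′ ∈ e ∷ L → A e′ → merge (label (src Γ e′)) ≡ merge (label (tgt Γ e′))
    constant′ (here refl) _   = trans merge-ℓs (sym merge-ℓt)
    constant′ (there e′∈L) Ae′ = cong merge (constant e′∈L Ae′)

    sound′ : ∀ {u w} → merge (label u) ≡ merge (label w) → Reach Γ A u w
    sound′ {u} {w} eq with label u ≟ ℓs | label w ≟ ℓs
    ... | yes u∼s | yes w∼s = sound (trans u∼s (sym w∼s))
    ... | no _    | no _    = sound eq
    ... | yes u∼s | no _    = Reach-trans (fwd e Ae (sound u∼s)) (sound eq)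
    ... | no _    | yes w∼s = Reach-sym (Reach-trans (fwd e Ae (sound w∼s)) (sound (sym eq)))

  open Labelling (labelling (allFin (nE Γ)))

  reach-or-cut : ∀ s t → Reach Γ A s t ⊎ ∃ λ (S : Fin (nV Γ) → Bool) →
                   S s ≡ true × S t ≡ false × (∀ e → A e → S (src Γ e) ≡ S (tgt Γ e))
  reach-or-cut s t with label s ≟ label t
  ... | yes s∼t = inj₁ (sound s∼t)
  ... | no s≁t  = inj₂ ((λ v → ⌊ label v ≟ label s ⌋) , ⌊≟⌋-refl (label s) , ⌊≟⌋-≢ (s≁t ∘ sym) ,
                        λ e Ae → cong (λ ℓ → ⌊ ℓ ≟ label s ⌋) (constant (∈-allFin e) Ae))

SameEnds : (Γ : Graph) → Fin (nE Γ) → Fin (nE Γ) → Set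
SameEnds Γ e e′ = Ends Γ e (src Γ e′) (tgt Γ e′)

module _ {Γ : Graph} where

  SameEnds-refl : ∀ e → SameEnds Γ e e
  SameEnds-refl e = inj₁ (refl , refl)

  Ends⇒SameEnds : ∀ {e e′ s t} → Ends Γ e s t → Ends Γ e′ s t → SameEnds Γ e e′
  Ends⇒SameEnds e-ends (inj₁ (refl , refl)) = e-ends
  Ends⇒SameEnds e-ends (inj₂ (refl , refl)) = Sum.swap e-ends

  Ends⇒Inc : ∀ {e s t u} → Ends Γ e s t → u ≡ s ⊎ u ≡ t → Inc Γ u e
  Ends⇒Inc (inj₁ (refl , refl)) u∈st = u∈st
  Ends⇒Inc (inj₂ (refl , refl)) u∈st = Sum.swap u∈st

  Inc⇒Ends : ∀ {e s t u} → Ends Γ e s t → Inc Γ u e → u ≡ s ⊎ u ≡ t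
  Inc⇒Ends (inj₁ (refl , refl)) u∈e = u∈e
  Inc⇒Ends (inj₂ (refl , refl)) u∈e = Sum.swap u∈e

  Parallel⇒distinct-ends : ∀ {e e′ s t} → Ends Γ e s t → Parallel Γ e e′ → s ≢ t
  Parallel⇒distinct-ends e-ends (u , w , u≢w , u∈e , _ , w∈e , _) s≡t
    with Inc⇒Ends e-ends u∈e | Inc⇒Ends e-ends w∈e
  ... | inj₁ refl | inj₁ refl = u≢w refl
  ... | inj₁ refl | inj₂ refl = u≢w s≡t
  ... | inj₂ refl | inj₁ refl = u≢w (sym s≡t)
  ... | inj₂ refl | inj₂ refl = u≢w refl

  Inc₂⇒Ends : ∀ {e s t} → s ≢ t → Inc Γ s e → Inc Γ t e → Ends Γ e s t
  Inc₂⇒Ends s≢t (inj₁ refl) (inj₂ refl) = inj₁ (refl , refl)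
  Inc₂⇒Ends s≢t (inj₂ refl) (inj₁ refl) = inj₂ (refl , refl)
  Inc₂⇒Ends s≢t (inj₁ refl) (inj₁ t≡s)  = ⊥-elim (s≢t (sym t≡s))
  Inc₂⇒Ends s≢t (inj₂ refl) (inj₂ t≡s)  = ⊥-elim (s≢t (sym t≡s))

  Parallel⇒Ends : ∀ {e c s t} → s ≢ t → Ends Γ c s t → Parallel Γ e c → Ends Γ e s t
  Parallel⇒Ends s≢t c-ends (u , w , u≢w , u∈e , u∈c , w∈e , w∈c)
    with Inc⇒Ends c-ends u∈c | Inc⇒Ends c-ends w∈c
  ... | inj₁ refl | inj₁ refl = ⊥-elim (u≢w refl)
  ... | inj₁ refl | inj₂ refl = Inc₂⇒Ends s≢t u∈e w∈e
  ... | inj₂ refl | inj₁ refl = Inc₂⇒Ends s≢t w∈e u∈e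
  ... | inj₂ refl | inj₂ refl = ⊥-elim (u≢w refl)

-- crossing Γ S inℰ inV e is the number of edges of Γ^ℰ over e joining V = S ∪ {v_e | inV} to its
-- complement, where inℰ says whether e ∈ ℰ; charge Γ (ℰ , D) S T is 2 (D(V) - μ(V) + δ_V / 2).
crossing : (Γ : Graph) → (Fin (nV Γ) → Bool) → Bool → Bool → Fin (nE Γ) → ℤ
crossing Γ S true  t e = [ S (src Γ e) xor t ] + [ S (tgt Γ e) xor t ]
crossing Γ S false _ e = [ S (src Γ e) xor S (tgt Γ e) ]

charge : (Γ : Graph) → PD Γ → (Fin (nV Γ) → Bool) → (Fin (nE Γ) → Bool) → ℤ
charge Γ x S T = + 2 * (∑[ S ] (lookup (Dv x)) + ∑ (λ e → [ T e ])) - ∑[ S ] (twiceμ Γ)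
                 + ∑ (λ e → crossing Γ S (lookup (Ex x) e) (T e) e)

_⊆ᴱ_ : ∀ {n} → (Fin n → Bool) → Vec Bool n → Set
T ⊆ᴱ E = ∀ e → T e ≡ true → lookup E e ≡ true

Inhabited : ∀ {m n} → (Fin m → Bool) → (Fin n → Bool) → Set
Inhabited S T = ∃ (λ v → S v ≡ true) ⊎ ∃ (λ e → T e ≡ true)

infixl 6 _-[_]+_
_-[_]+_ : ∀ {Γ} → PD Γ → Fin (nE Γ) → Fin (nV Γ) → PD Γ
x -[ e ]+ u = _-v[_]+_ _ x e u

QuasistableFor : (Γ : Graph) → Fin (nV Γ) → (x : PD Γ) →
                 ((Fin (nV Γ) → Bool) → (Fin (nE Γ) → Bool) → ℤ) → Set
QuasistableFor Γ v₀ x q =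
  (deg Γ x ≡ genus Γ - 1ℤ) ×
  (∀ S T → T ⊆ᴱ Ex x → Inhabited S T → (S v₀ ≡ true → 0ℤ ≤ q S T) × (S v₀ ≡ false → 0ℤ < q S T))

Quasistable′ : (Γ : Graph) → Fin (nV Γ) → PD Γ → Set
Quasistable′ Γ v₀ x = QuasistableFor Γ v₀ x (charge Γ x)

QuasistableFor-transfer :
  ∀ {Γ v₀} {x y : PD Γ} {q q′} → deg Γ y ≡ deg Γ x →
  (τ : (Fin (nV Γ) → Bool) → (Fin (nE Γ) → Bool) → Fin (nE Γ) → Bool) →
  (∀ {S T} → T ⊆ᴱ Ex y → τ S T ⊆ᴱ Ex x) →
  (∀ {S T} → T ⊆ᴱ Ex y → Inhabited S T → Inhabited S (τ S T)) →
  (∀ {S T} → T ⊆ᴱ Ex y → q′ S T ≡ q S (τ S T)) →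
  QuasistableFor Γ v₀ x q → QuasistableFor Γ v₀ y q′
QuasistableFor-transfer y≡x τ ⊆-τ inhabited-τ q′≡q (deg-x , bounds) = trans y≡x deg-x , λ S T T⊆ inh →
  let (q≥0 , q>0) = bounds S (τ S T) (⊆-τ T⊆) (inhabited-τ T⊆ inh) in
  (λ p → subst (0ℤ ≤_) (sym (q′≡q T⊆)) (q≥0 p)) , (λ p → subst (0ℤ <_) (sym (q′≡q T⊆)) (q>0 p))

QuasistableFor-cong : ∀ {Γ v₀ x q q′} → (∀ S T → q S T ≡ q′ S T) →
                      QuasistableFor Γ v₀ x q → QuasistableFor Γ v₀ x q′
QuasistableFor-cong {x = x} q≡q′ =
  QuasistableFor-transfer {x = x} {y = x} refl (λ _ T → T) id (λ _ → id) (λ {S} {T} _ → sym (q≡q′ S T))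

private
  VertexTerms EdgeTerms : Set
  VertexTerms = (Γ : Graph) → Fin (nV Γ) → Vec Bool (nE Γ) → Vec ℤ (nV Γ) →
                (Fin (nV Γ) → Bool) → Fin (nV Γ) → ℤ
  EdgeTerms   = (Γ : Graph) → Vec Bool (nE Γ) → (Fin (nV Γ) → Bool) → (Fin (nE Γ) → Bool) → Fin (nE Γ) → ℤ

  -- Defs binds the summands of the charge in where-blocks, so they cannot be named;
  -- the metavariables below are solved for them by pattern unification.
  Quasistable-unfolded :
    Σ VertexTerms λ d → Σ VertexTerms λ m → Σ EdgeTerms λ c → ∀ Γ v₀ E D →
      Quasistable Γ v₀ (pd E D) ≡ QuasistableFor Γ v₀ (pd E D)
        (λ S T → + 2 * (∑ (d Γ v₀ E D S) + ∑ (λ e → [ T e ])) - ∑ (m Γ v₀ E D S) + ∑ (c Γ E S T))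
  Quasistable-unfolded = _ , _ , _ , λ _ _ _ _ → refl

  d-summand μ-summand : VertexTerms
  d-summand = proj₁ Quasistable-unfolded
  μ-summand = proj₁ (proj₂ Quasistable-unfolded)

  δ-summand : EdgeTerms
  δ-summand = proj₁ (proj₂ (proj₂ Quasistable-unfolded))

  d-summand≡ : ∀ Γ v₀ E D S v → d-summand Γ v₀ E D S v ≡ (if S v then lookup D v else 0ℤ)
  d-summand≡ Γ v₀ E D S v with S v
  ... | true  = refl
  ... | false = refl

  μ-summand≡ : ∀ Γ v₀ E D S v → μ-summand Γ v₀ E D S v ≡ (if S v then twiceμ Γ v else 0ℤ)
  μ-summand≡ Γ v₀ E D S v with S v
  ... | true  = refl
  ... | false = refl

  δ-summand≡ : ∀ Γ E S T e → δ-summand Γ E S T e ≡ crossing Γ S (lookup E e) (T e) e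
  δ-summand≡ Γ E S T e with lookup E e
  ... | true  = refl
  ... | false = refl

  summands≡charge : ∀ Γ v₀ E D S T →
    + 2 * (∑ (d-summand Γ v₀ E D S) + ∑ (λ e → [ T e ])) - ∑ (μ-summand Γ v₀ E D S) + ∑ (δ-summand Γ E S T)
    ≡ charge Γ (pd E D) S T
  summands≡charge Γ v₀ E D S T =
    cong₂ _+_ (cong₂ _-_ (cong (λ a → + 2 * (a + ∑ (λ e → [ T e ]))) (∑-cong (d-summand≡ Γ v₀ E D S)))
                         (∑-cong (μ-summand≡ Γ v₀ E D S)))
              (∑-cong (δ-summand≡ Γ E S T))

Quasistable⇒Quasistable′ : ∀ {Γ v₀} x → Quasistable Γ v₀ x → Quasistable′ Γ v₀ x
Quasistable⇒Quasistable′ {Γ} {v₀} (pd E D) q =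
  QuasistableFor-cong {Γ} {v₀} {pd E D} (summands≡charge Γ v₀ E D)
    (subst id (proj₂ (proj₂ (proj₂ Quasistable-unfolded)) Γ v₀ E D) q)

Quasistable′⇒Quasistable : ∀ {Γ v₀} x → Quasistable′ Γ v₀ x → Quasistable Γ v₀ x
Quasistable′⇒Quasistable {Γ} {v₀} (pd E D) q =
  subst id (sym (proj₂ (proj₂ (proj₂ Quasistable-unfolded)) Γ v₀ E D))
    (QuasistableFor-cong {Γ} {v₀} {pd E D} (λ S T → sym (summands≡charge Γ v₀ E D S T)) q)

∑-raise : ∀ {n} (D : Vec ℤ n) u → ∑ (lookup (updateAt D u (λ z → z + 1ℤ))) ≡ ∑ (lookup D) + 1ℤ
∑-raise D u = ∑-perturb u (λ i i≢u → lookup∘updateAt′ i u i≢u D) (lookup∘updateAt u D)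

∑-unmark : ∀ {n} (E : Vec Bool n) {e} → lookup E e ≡ true →
           ∑ (λ i → [ lookup E i ]) ≡ ∑ (λ i → [ lookup (E [ e ]≔ false) i ]) + 1ℤ
∑-unmark E {e} E∋e = ∑-perturb e (λ i i≢e → cong [_] (sym (lookup∘update′ i≢e E false))) at-e
  where
  at-e : [ lookup E e ] ≡ [ lookup (E [ e ]≔ false) e ] + 1ℤ
  at-e rewrite E∋e | lookup∘update e E false = refl

deg-specialise : ∀ {Γ} E D {e u} → lookup E e ≡ true → deg Γ (pd E D -[ e ]+ u) ≡ deg Γ (pd E D)
deg-specialise {Γ} E D {e} {u} E∋e =
  trans (cong (_+ ∑ [E′]) (∑-raise D u))
        (trans (reassoc (∑ (lookup D)) (∑ [E′])) (cong (_+_ (∑ (lookup D))) (sym (∑-unmark E E∋e))))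
  where
  [E′] : Fin (nE Γ) → ℤ
  [E′] i = [ lookup (E [ e ]≔ false) i ]
  reassoc : ∀ a b → a + 1ℤ + b ≡ a + (b + 1ℤ)
  reassoc = solve-∀

xor-through : ∀ a b c → c ≡ a ⊎ c ≡ b → [ a xor b ] ≡ [ a xor c ] + [ b xor c ]
xor-through true  true  true  _ = refl
xor-through true  false true  _ = refl
xor-through true  false false _ = refl
xor-through false true  true  _ = refl
xor-through false true  false _ = refl
xor-through false false false _ = refl
xor-through true  true  false (inj₁ ())
xor-through true  true  false (inj₂ ())
xor-through false false true  (inj₁ ())
xor-through false false true  (inj₂ ())

crossing-subdivide : ∀ {Γ} S {u e} t → Inc Γ u e → crossing Γ S false t e ≡ crossing Γ S true (S u) e
crossing-subdivide {Γ} S {u} {e} _ u∈e =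
  xor-through (S (src Γ e)) (S (tgt Γ e)) (S u) (Sum.map (cong S) (cong S) u∈e)

module _ {Γ : Graph} {v₀ : Fin (nV Γ)} (E : Vec Bool (nE Γ)) (D : Vec ℤ (nV Γ))
         {e : Fin (nE Γ)} {u : Fin (nV Γ)} (E∋e : lookup E e ≡ true) (u∈e : Inc Γ u e) where

  private
    E′ : Vec Bool (nE Γ)
    E′ = E [ e ]≔ false

    -- v_e is put on the side of u, which leaves the charge unchanged.
    subdivided : (Fin (nV Γ) → Bool) → (Fin (nE Γ) → Bool) → Fin (nE Γ) → Bool
    subdivided S T′ = VF.updateAt T′ e (λ _ → S u)

    T′-unmarked : ∀ {T′} → T′ ⊆ᴱ E′ → T′ e ≡ false
    T′-unmarked {T′} T′⊆ with T′ e in T′e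
    ... | false = refl
    ... | true  = ⊥-elim (not-¬ (lookup∘update e E false) (T′⊆ e T′e))

    subdivided-⊆ : ∀ S {T′} → T′ ⊆ᴱ E′ → subdivided S T′ ⊆ᴱ E
    subdivided-⊆ S {T′} T′⊆ i Ti with i ≟ e
    ... | yes refl = E∋e
    ... | no i≢e   =
      trans (sym (lookup∘update′ i≢e E false)) (T′⊆ i (trans (sym (VF.updateAt-minimal i e T′ i≢e)) Ti))

    subdivided-inhabited : ∀ S {T′} → T′ ⊆ᴱ E′ → Inhabited S T′ → Inhabited S (subdivided S T′)
    subdivided-inhabited S T′⊆ (inj₁ v∈S)       = inj₁ v∈S
    subdivided-inhabited S {T′} T′⊆ (inj₂ (i , T′i)) with i ≟ e
    ... | yes refl = ⊥-elim (not-¬ (T′-unmarked T′⊆) T′i)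
    ... | no i≢e   = inj₂ (i , trans (VF.updateAt-minimal i e T′ i≢e) T′i)

    charge-subdivided : ∀ S {T′} → T′ ⊆ᴱ E′ →
      charge Γ (pd E D -[ e ]+ u) S T′ ≡ charge Γ (pd E D) S (subdivided S T′)
    charge-subdivided S {T′} T′⊆ =
      trans (cong₂ (λ a c → + 2 * (a + ∑ [T′]) - M + c) ∑S-raised (∑-cong crossing≡))
            (trans (shuffle (∑[ S ] (lookup D)) [ S u ] (∑ [T′]) M C)
                   (cong (λ b → + 2 * (∑[ S ] (lookup D) + b) - M + C) (sym ∑T)))
      where
      T : Fin (nE Γ) → Bool
      T = subdivided S T′
      [T′] [T] : Fin (nE Γ) → ℤ
      [T′] i = [ T′ i ]
      [T] i = [ T i ]
      M C : ℤ
      M = ∑[ S ] (twiceμ Γ)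
      C = ∑ (λ i → crossing Γ S (lookup E i) (T i) i)

      ∑S-raised : ∑[ S ] (lookup (updateAt D u (λ z → z + 1ℤ))) ≡ ∑[ S ] (lookup D) + [ S u ]
      ∑S-raised = ∑-perturb u (λ i i≢u → cong (if S i then_else 0ℤ) (lookup∘updateAt′ i u i≢u D)) at-u
        where
        at-u : (if S u then lookup (updateAt D u (λ z → z + 1ℤ)) u else 0ℤ)
               ≡ (if S u then lookup D u else 0ℤ) + [ S u ]
        at-u rewrite lookup∘updateAt u {λ z → z + 1ℤ} D with S u
        ... | true  = refl
        ... | false = refl

      ∑T : ∑ [T] ≡ ∑ [T′] + [ S u ]
      ∑T = ∑-perturb e (λ i i≢e → cong [_] (VF.updateAt-minimal i e T′ i≢e)) at-e
        where
        at-e : [ T e ] ≡ [ T′ e ] + [ S u ]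
        at-e rewrite VF.updateAt-updates e {λ _ → S u} T′ | T′-unmarked T′⊆ = sym (ℤ.+-identityˡ _)

      crossing≡ : ∀ i → crossing Γ S (lookup E′ i) (T′ i) i ≡ crossing Γ S (lookup E i) (T i) i
      crossing≡ i with i ≟ e
      ... | yes refl rewrite lookup∘update i E false | E∋e | VF.updateAt-updates i {λ _ → S u} T′ =
        crossing-subdivide {Γ} S (T′ i) u∈e
      ... | no i≢e rewrite lookup∘update′ i≢e E false | VF.updateAt-minimal i e {λ _ → S u} T′ i≢e = refl

      shuffle : ∀ a σ b m c → + 2 * (a + σ + b) - m + c ≡ + 2 * (a + (b + σ)) - m + c
      shuffle = solve-∀

  Quasistable′-specialise : Quasistable′ Γ v₀ (pd E D) → Quasistable′ Γ v₀ (pd E D -[ e ]+ u)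
  Quasistable′-specialise =
    QuasistableFor-transfer {Γ} {v₀} {pd E D} {pd E D -[ e ]+ u} (deg-specialise {Γ} E D {e} {u} E∋e) subdivided
      (λ {S} → subdivided-⊆ S) (λ {S} → subdivided-inhabited S) (λ {S} → charge-subdivided S)

crossing-SameEnds : ∀ {Γ} S b t {e e′} → SameEnds Γ e e′ → crossing Γ S b t e ≡ crossing Γ S b t e′
crossing-SameEnds S true  t (inj₁ (p , q)) rewrite p | q = refl
crossing-SameEnds {Γ} S true  t {e′ = e′} (inj₂ (p , q)) rewrite p | q =
  ℤ.+-comm [ S (tgt Γ e′) xor t ] [ S (src Γ e′) xor t ]
crossing-SameEnds S false t (inj₁ (p , q)) rewrite p | q = refl
crossing-SameEnds {Γ} S false t {e′ = e′} (inj₂ (p , q)) rewrite p | q =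
  cong [_] (xor-comm (S (tgt Γ e′)) (S (src Γ e′)))

module _ {Γ : Graph} {v₀ : Fin (nV Γ)} (π : Permutation′ (nE Γ)) (π-ends : ∀ i → SameEnds Γ (π ⟨$⟩ʳ i) i)
         {E E′ : Vec Bool (nE Γ)} (E′≗E∘π : ∀ i → lookup E′ i ≡ lookup E (π ⟨$⟩ʳ i))
         (D : Vec ℤ (nV Γ)) where

  private
    relabel : (Fin (nV Γ) → Bool) → (Fin (nE Γ) → Bool) → Fin (nE Γ) → Bool
    relabel _ T = T ∘ (π ⟨$⟩ˡ_)

    ∑-relabel : ∀ (f : Fin (nE Γ) → ℤ) → ∑ f ≡ ∑ (f ∘ (π ⟨$⟩ˡ_))
    ∑-relabel f =
      trans (∑-cong (λ i → cong f (sym (inverseˡ π {i})))) (sym (∑-permute (f ∘ (π ⟨$⟩ˡ_)) π))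

    deg≡ : deg Γ (pd E′ D) ≡ deg Γ (pd E D)
    deg≡ = cong (_+_ (∑ (lookup D)))
             (trans (∑-cong (cong [_] ∘ E′≗E∘π)) (sym (∑-permute (λ i → [ lookup E i ]) π)))

    relabel-⊆ : ∀ {S T} → T ⊆ᴱ E′ → relabel S T ⊆ᴱ E
    relabel-⊆ T⊆ j Tj =
      trans (sym (trans (E′≗E∘π (π ⟨$⟩ˡ j)) (cong (lookup E) (inverseʳ π)))) (T⊆ (π ⟨$⟩ˡ j) Tj)

    relabel-inhabited : ∀ {S T} → T ⊆ᴱ E′ → Inhabited S T → Inhabited S (relabel S T)
    relabel-inhabited _ (inj₁ v∈S)     = inj₁ v∈S
    relabel-inhabited {T = T} _ (inj₂ (i , Ti)) = inj₂ (π ⟨$⟩ʳ i , trans (cong T (inverseˡ π)) Ti)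

    charge-relabel : ∀ S {T} → T ⊆ᴱ E′ → charge Γ (pd E′ D) S T ≡ charge Γ (pd E D) S (relabel S T)
    charge-relabel S {T} _ =
      cong₂ (λ b c → + 2 * (∑[ S ] (lookup D) + b) - ∑[ S ] (twiceμ Γ) + c)
            (∑-relabel (λ i → [ T i ]))
            (trans (∑-cong crossing≡)
                   (sym (∑-permute (λ j → crossing Γ S (lookup E j) (T (π ⟨$⟩ˡ j)) j) π)))
      where
      crossing≡ : ∀ i → crossing Γ S (lookup E′ i) (T i) i
                      ≡ crossing Γ S (lookup E (π ⟨$⟩ʳ i)) (T (π ⟨$⟩ˡ (π ⟨$⟩ʳ i))) (π ⟨$⟩ʳ i)
      crossing≡ i rewrite E′≗E∘π i | inverseˡ π {i} =
        sym (crossing-SameEnds S (lookup E (π ⟨$⟩ʳ i)) (T i) (π-ends i))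

  Quasistable′-permute : Quasistable′ Γ v₀ (pd E D) → Quasistable′ Γ v₀ (pd E′ D)
  Quasistable′-permute = QuasistableFor-transfer {Γ} {v₀} {pd E D} {pd E′ D} deg≡ relabel
      (λ {S} → relabel-⊆ {S}) (λ {S} → relabel-inhabited {S}) (λ {S} → charge-relabel S)

handshake : ∀ Γ → ∑ (val Γ) ≡ + nE Γ * + 2
handshake Γ = begin
  ∑ (val Γ)                    ≡⟨ ∑-comm (λ v e → ends e v) ⟩
  ∑ (λ e → ∑ (ends e))         ≡⟨ ∑-cong (λ e → trans (∑-distrib-+ (src-at e) (tgt-at e))
                                                      (cong₂ _+_ (∑-indicator (src Γ e)) (∑-indicator (tgt Γ e)))) ⟩
  ∑ {nE Γ} (λ _ → + 2)         ≡⟨ ∑-const {nE Γ} (+ 2) ⟩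
  + nE Γ * + 2                 ∎
  where
  open ≡-Reasoning
  src-at tgt-at ends : Fin (nE Γ) → Fin (nV Γ) → ℤ
  src-at e v = [ ⌊ src Γ e ≟ v ⌋ ]
  tgt-at e v = [ ⌊ tgt Γ e ≟ v ⌋ ]
  ends e v = src-at e v + tgt-at e v

∑-twiceμ : ∀ Γ → ∑ (twiceμ Γ) ≡ + 2 * (+ nE Γ - + nV Γ)
∑-twiceμ Γ = trans (∑-distrib-+ (val Γ) (λ _ → - + 2))
                   (trans (cong₂ _+_ (handshake Γ) (∑-const {nV Γ} (- + 2))) (arith (+ nE Γ) (+ nV Γ)))
  where
  arith : ∀ m n → m * + 2 + n * - + 2 ≡ + 2 * (m - n)
  arith = solve-∀

crossing-complement : ∀ {Γ} S b e → (b ≡ false → S (src Γ e) ≡ S (tgt Γ e)) →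
                      crossing Γ S b false e + crossing Γ (not ∘ S) b false e ≡ [ b ] + [ b ]
crossing-complement {Γ} S true e _ with S (src Γ e) | S (tgt Γ e)
... | true  | true  = refl
... | true  | false = refl
... | false | true  = refl
... | false | false = refl
crossing-complement {Γ} S false e same rewrite same refl with S (tgt Γ e)
... | true  = refl
... | false = refl

charge-complement : ∀ {Γ} x S → (∀ e → lookup (Ex x) e ≡ false → S (src Γ e) ≡ S (tgt Γ e)) →
  charge Γ x S (λ _ → false) + charge Γ x (not ∘ S) (λ _ → false) ≡ + 2 * (deg Γ x - (genus Γ - 1ℤ))
charge-complement {Γ} x S cut = begin
  (+ 2 * (a₁ + z) - m₁ + c₁) + (+ 2 * (a₂ + z) - m₂ + c₂)
    ≡⟨ regroup a₁ a₂ z m₁ m₂ c₁ c₂ ⟩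
  + 2 * (a₁ + a₂ + z + z) - (m₁ + m₂) + (c₁ + c₂)
    ≡⟨ settle (∑[]-complement S (lookup (Dv x))) (∑-zero {nE Γ})
              (trans (∑[]-complement S (twiceμ Γ)) (∑-twiceμ Γ)) ∑-crossings ⟩
  + 2 * (deg Γ x - (genus Γ - 1ℤ))
    ∎
  where
  open ≡-Reasoning
  a₁ a₂ z m₁ m₂ c₁ c₂ ∑ℰ : ℤ
  a₁ = ∑[ S ] (lookup (Dv x))
  a₂ = ∑[ not ∘ S ] (lookup (Dv x))
  z  = ∑ {nE Γ} (λ _ → 0ℤ)
  m₁ = ∑[ S ] (twiceμ Γ)
  m₂ = ∑[ not ∘ S ] (twiceμ Γ)
  c₁ = ∑ (λ e → crossing Γ S (lookup (Ex x) e) false e)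
  c₂ = ∑ (λ e → crossing Γ (not ∘ S) (lookup (Ex x) e) false e)
  ∑ℰ = ∑ (λ e → [ lookup (Ex x) e ])

  ∑-crossings : c₁ + c₂ ≡ ∑ℰ + ∑ℰ
  ∑-crossings = trans (sym (∑-distrib-+ (λ e → crossing Γ S (lookup (Ex x) e) false e)
                                        (λ e → crossing Γ (not ∘ S) (lookup (Ex x) e) false e)))
                      (trans (∑-cong (λ e → crossing-complement S (lookup (Ex x) e) e (cut e)))
                             (∑-distrib-+ (λ e → [ lookup (Ex x) e ]) (λ e → [ lookup (Ex x) e ])))

  regroup : ∀ a₁ a₂ z m₁ m₂ c₁ c₂ → (+ 2 * (a₁ + z) - m₁ + c₁) + (+ 2 * (a₂ + z) - m₂ + c₂)
                                     ≡ + 2 * (a₁ + a₂ + z + z) - (m₁ + m₂) + (c₁ + c₂)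
  regroup = solve-∀

  collect : ∀ d ε m n → + 2 * (d + 0ℤ + 0ℤ) - + 2 * (m - n) + (ε + ε)
                       ≡ + 2 * (d + ε - (m - n + 1ℤ - 1ℤ))
  collect = solve-∀

  settle : ∀ {a z m c} → a ≡ ∑ (lookup (Dv x)) → z ≡ 0ℤ → m ≡ + 2 * (+ nE Γ - + nV Γ) → c ≡ ∑ℰ + ∑ℰ →
           + 2 * (a + z + z) - m + c ≡ + 2 * (deg Γ x - (genus Γ - 1ℤ))
  settle refl refl refl refl = collect (∑ (lookup (Dv x))) ∑ℰ (+ nE Γ) (+ nV Γ)

Quasistable′⇒no-cut : ∀ {Γ v₀ x} (S : Fin (nV Γ) → Bool) {s t} → S s ≡ true → S t ≡ false →
                      (∀ e → lookup (Ex x) e ≡ false → S (src Γ e) ≡ S (tgt Γ e)) → ¬ Quasistable′ Γ v₀ x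
Quasistable′⇒no-cut {Γ} {v₀} {x} S {s} {t} s∈S t∉S cut (deg≡ , bounds) = with-v₀ (S v₀) refl
  where
  q₁ q₂ : ℤ
  q₁ = charge Γ x S (λ _ → false)
  q₂ = charge Γ x (not ∘ S) (λ _ → false)

  q₁+q₂≡0 : q₁ + q₂ ≡ 0ℤ
  q₁+q₂≡0 = begin
    q₁ + q₂                                    ≡⟨ charge-complement x S cut ⟩
    + 2 * (deg Γ x - (genus Γ - 1ℤ))           ≡⟨ cong (λ d → + 2 * (d - (genus Γ - 1ℤ))) deg≡ ⟩
    + 2 * ((genus Γ - 1ℤ) - (genus Γ - 1ℤ))    ≡⟨ cong (+ 2 *_) (ℤ.+-inverseʳ (genus Γ - 1ℤ)) ⟩
    0ℤ                                         ∎
    where open ≡-Reasoning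

  bounds₁ : (S v₀ ≡ true → 0ℤ ≤ q₁) × (S v₀ ≡ false → 0ℤ < q₁)
  bounds₁ = bounds S (λ _ → false) (λ _ ()) (inj₁ (s , s∈S))
  bounds₂ : (not (S v₀) ≡ true → 0ℤ ≤ q₂) × (not (S v₀) ≡ false → 0ℤ < q₂)
  bounds₂ = bounds (not ∘ S) (λ _ → false) (λ _ ()) (inj₁ (t , cong not t∉S))

  with-v₀ : ∀ b → S v₀ ≡ b → ⊥
  with-v₀ true  v₀∈S =
    ℤ.<-irrefl (sym q₁+q₂≡0) (ℤ.+-mono-≤-< (proj₁ bounds₁ v₀∈S) (proj₂ bounds₂ (cong not v₀∈S)))
  with-v₀ false v₀∉S =
    ℤ.<-irrefl (sym q₁+q₂≡0) (ℤ.+-mono-<-≤ (proj₂ bounds₁ v₀∉S) (proj₁ bounds₂ (cong not v₀∉S)))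

Quasistable′⇒complement-connected : ∀ {Γ v₀ x} → Quasistable′ Γ v₀ x →
                                    ConnectedUsing Γ (λ e → lookup (Ex x) e ≡ false)
Quasistable′⇒complement-connected {Γ} {x = x} q u w with reach-or-cut Γ (λ e → lookup (Ex x) e ≟ᴮ false) u w
... | inj₁ u⇝w                      = u⇝w
... | inj₂ (S , u∈S , w∉S , cut) = ⊥-elim (Quasistable′⇒no-cut {x = x} S u∈S w∉S cut q)

quasistable-specialise : ∀ {Γ v₀ e u} x → lookup (Ex x) e ≡ true → Inc Γ u e →
                         Quasistable Γ v₀ x → Quasistable Γ v₀ (x -[ e ]+ u)
quasistable-specialise x x∋e u∈e q = Quasistable′⇒Quasistable (x -[ _ ]+ _)
  (Quasistable′-specialise (Ex x) (Dv x) x∋e u∈e (Quasistable⇒Quasistable′ x q))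

quasistable-permute : ∀ {Γ v₀} (π : Permutation′ (nE Γ)) → (∀ i → SameEnds Γ (π ⟨$⟩ʳ i) i) →
                      ∀ {E E′ : Vec Bool (nE Γ)} {D} → (∀ i → lookup E′ i ≡ lookup E (π ⟨$⟩ʳ i)) →
                      Quasistable Γ v₀ (pd E D) → Quasistable Γ v₀ (pd E′ D)
quasistable-permute {v₀ = v₀} π π-ends {E} {E′} {D} E′≗E∘π q = Quasistable′⇒Quasistable (pd E′ D)
  (Quasistable′-permute {v₀ = v₀} π π-ends {E} {E′} E′≗E∘π D (Quasistable⇒Quasistable′ (pd E D) q))

quasistable⇒complement-connected : ∀ {Γ v₀} x → Quasistable Γ v₀ x →
                                   ConnectedUsing Γ (λ e → lookup (Ex x) e ≡ false)
quasistable⇒complement-connected x q = Quasistable′⇒complement-connected {x = x} (Quasistable⇒Quasistable′ x q)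

lookup-raise : ∀ {n} (D : Vec ℤ n) u v → lookup (updateAt D u (λ z → z + 1ℤ)) v ≡ lookup D v + [ ⌊ u ≟ v ⌋ ]
lookup-raise D u v with u ≟ v
... | yes refl = lookup∘updateAt u D
... | no u≢v   = trans (lookup∘updateAt′ v u (u≢v ∘ sym) D) (sym (ℤ.+-identityʳ _))

i<i+1 : ∀ i → i < i + 1ℤ
i<i+1 i = ℤ.suc[i]≤j⇒i<j (ℤ.≤-reflexive (ℤ.+-comm 1ℤ i))

-- The order of Defs, wrapped in a record so that both sides can be inferred from its type.
infix 4 _⊒_
record _⊒_ {Γ : Graph} (x y : PD Γ) : Set where
  constructor ⟨_⟩
  field unwrap : _≽_ Γ x y

module _ {Γ : Graph} where

  ⊒-refl : ∀ (x : PD Γ) → x ⊒ x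
  ⊒-refl (pd E D) = ⟨ (λ _ E∋e → E∋e) , src Γ , (λ e _ → inj₁ refl) , (λ v → sym (nothing-removed v)) ⟩
    where
    nothing-removed : ∀ v → lookup D v + ∑ (λ e → [ (lookup E e ∧ not (lookup E e)) ∧ ⌊ src Γ e ≟ v ⌋ ])
                            ≡ lookup D v
    nothing-removed v =
      trans (cong (_+_ (lookup D v))
                  (trans (∑-cong (λ e → cong (λ b → [ b ∧ ⌊ src Γ e ≟ v ⌋ ]) (∧-inverseʳ (lookup E e))))
                         (∑-zero {nE Γ})))
            (ℤ.+-identityʳ (lookup D v))

  ⊒⇒⊇ : ∀ {x y : PD Γ} {e} → x ⊒ y → lookup (Ex y) e ≡ true → lookup (Ex x) e ≡ true
  ⊒⇒⊇ {e = e} ⟨ ⊇ , _ ⟩ = ⊇ e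

  ⊒⇒Dv≤ : ∀ {x y : PD Γ} v → x ⊒ y → lookup (Dv x) v ≤ lookup (Dv y) v
  ⊒⇒Dv≤ {pd E D} {pd E′ D′} v ⟨ _ , φ , _ , D′≡ ⟩ =
    subst (lookup D v ≤_) (sym (D′≡ v)) (ℤ.i≤i+j (lookup D v) _ ⦃ nonNegative (∑-nonneg (λ e → []≥0 (moved e))) ⦄)
    where
    moved : Fin (nE Γ) → Bool
    moved e = (lookup E e ∧ not (lookup E′ e)) ∧ ⌊ φ e ≟ v ⌋

    []≥0 : ∀ b → 0ℤ ≤ [ b ]
    []≥0 true  = +≤+ z≤n
    []≥0 false = +≤+ z≤n

  ⊒-specialise : ∀ {E E′ : Vec Bool (nE Γ)} {D c p} → lookup E c ≡ true → Inc Γ p c →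
                 (∀ e → lookup E′ e ≡ lookup (E [ c ]≔ false) e) →
                 pd E D ⊒ pd E′ (updateAt D p (λ z → z + 1ℤ))
  ⊒-specialise {E} {E′} {D} {c} {p} E∋c p∈c E′≗ = ⟨ ⊇ , (λ _ → p) , p∈removed , D′≡ ⟩
    where
    removed≡ : ∀ e → lookup E e ∧ not (lookup E′ e) ≡ ⌊ e ≟ c ⌋
    removed≡ e rewrite E′≗ e with e ≟ c
    ... | yes refl rewrite lookup∘update e E false | E∋c = refl
    ... | no e≢c   rewrite lookup∘update′ e≢c E false = ∧-inverseʳ (lookup E e)

    ⊇ : ∀ e → lookup E′ e ≡ true → lookup E e ≡ true
    ⊇ e E′∋e with e ≟ c
    ... | yes refl = E∋c
    ... | no e≢c   = trans (sym (lookup∘update′ e≢c E false)) (trans (sym (E′≗ e)) E′∋e)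

    p∈removed : ∀ e → lookup E e ∧ not (lookup E′ e) ≡ true → Inc Γ p e
    p∈removed e removed with e ≟ c | removed≡ e
    ... | yes refl | _ = p∈c
    ... | no _     | removed≡false = ⊥-elim (not-¬ removed≡false removed)

    D′≡ : ∀ v → lookup (updateAt D p (λ z → z + 1ℤ)) v
                ≡ lookup D v + ∑ (λ e → [ (lookup E e ∧ not (lookup E′ e)) ∧ ⌊ p ≟ v ⌋ ])
    D′≡ v = trans (lookup-raise D p v) (cong (_+_ (lookup D v)) (sym (trans
      (∑-single c (λ e e≢c → cong (λ b → [ b ∧ ⌊ p ≟ v ⌋ ]) (trans (removed≡ e) (⌊≟⌋-≢ e≢c))))
      (cong (λ b → [ b ∧ ⌊ p ≟ v ⌋ ]) (trans (removed≡ c) (⌊≟⌋-refl c))))))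

  ⊒-permute : ∀ (π : Permutation′ (nE Γ)) → (∀ i → SameEnds Γ (π ⟨$⟩ʳ i) i) →
              ∀ {x : PD Γ} {E E′ : Vec Bool (nE Γ)} {D} →
              (∀ i → lookup (Ex x) (π ⟨$⟩ʳ i) ≡ lookup (Ex x) i) →
              (∀ i → lookup E′ i ≡ lookup E (π ⟨$⟩ʳ i)) →
              x ⊒ pd E D → x ⊒ pd E′ D
  ⊒-permute π π-ends {pd EZ DZ} {E} {E′} {D} EZ∘π≗EZ E′≗E∘π ⟨ ⊇ , φ , φ∈removed , D≡ ⟩ =
    ⟨ ⊇′ , φ ∘ (π ⟨$⟩ʳ_) , φπ∈removed , D≡′ ⟩
    where
    removed≡ : ∀ i → lookup EZ i ∧ not (lookup E′ i) ≡ lookup EZ (π ⟨$⟩ʳ i) ∧ not (lookup E (π ⟨$⟩ʳ i))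
    removed≡ i = cong₂ (λ b b′ → b ∧ not b′) (sym (EZ∘π≗EZ i)) (E′≗E∘π i)

    φπ∈removed : ∀ i → lookup EZ i ∧ not (lookup E′ i) ≡ true → Inc Γ (φ (π ⟨$⟩ʳ i)) i
    φπ∈removed i removed = Inc⇒Ends {Γ} (π-ends i) (φ∈removed (π ⟨$⟩ʳ i) (trans (sym (removed≡ i)) removed))

    ⊇′ : ∀ i → lookup E′ i ≡ true → lookup EZ i ≡ true
    ⊇′ i E′∋i = trans (sym (EZ∘π≗EZ i)) (⊇ (π ⟨$⟩ʳ i) (trans (sym (E′≗E∘π i)) E′∋i))

    D≡′ : ∀ v → lookup D v ≡ lookup DZ v + ∑ (λ i → [ (lookup EZ i ∧ not (lookup E′ i)) ∧ ⌊ φ (π ⟨$⟩ʳ i) ≟ v ⌋ ])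
    D≡′ v = trans (D≡ v) (cong (_+_ (lookup DZ v)) (trans
      (∑-permute (λ e → [ (lookup EZ e ∧ not (lookup E e)) ∧ ⌊ φ e ≟ v ⌋ ]) π)
      (∑-cong (λ i → cong (λ b → [ b ∧ ⌊ φ (π ⟨$⟩ʳ i) ≟ v ⌋ ]) (sym (removed≡ i))))))

  ≡⇒⊒ : ∀ {x y : PD Γ} → x ≡ y → x ⊒ y
  ≡⇒⊒ {x} refl = ⊒-refl x

  ⋡-level : ∀ {x y : PD Γ} v → lookup (Dv y) v < lookup (Dv x) v → ¬ (x ⊒ y)
  ⋡-level v y<x x⊒y = ℤ.<⇒≱ y<x (⊒⇒Dv≤ v x⊒y)

  ⋡-edge : ∀ {x y : PD Γ} {e} → lookup (Ex y) e ≡ true → lookup (Ex x) e ≡ false → ¬ (x ⊒ y)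
  ⋡-edge y∋e x∌e x⊒y = not-¬ x∌e (⊒⇒⊇ x⊒y y∋e)

  transpose-SameEnds : ∀ {c c′ s t} → Ends Γ c s t → Ends Γ c′ s t →
                       ∀ i → SameEnds Γ (PC.transpose c c′ i) i
  transpose-SameEnds {c} {c′} c-ends c′-ends = transpose-elim {P = λ k l → SameEnds Γ l k} {c} {c′}
    (Ends⇒SameEnds {Γ} c′-ends c-ends) (Ends⇒SameEnds {Γ} c-ends c′-ends) (λ k _ _ → SameEnds-refl {Γ} k)

module _ (Γ : Graph) (a b : Fin (nE Γ)) where

  lookup-pairSet : ∀ e → lookup (pairSet Γ a b) e ≡ ⌊ e ≟ a ⌋ ∨ ⌊ e ≟ b ⌋
  lookup-pairSet = lookup∘tabulate (λ e → ⌊ e ≟ a ⌋ ∨ ⌊ e ≟ b ⌋)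

  pairSet-∋ˡ : lookup (pairSet Γ a b) a ≡ true
  pairSet-∋ˡ rewrite lookup-pairSet a | ⌊≟⌋-refl a = refl

  pairSet-∋ʳ : lookup (pairSet Γ a b) b ≡ true
  pairSet-∋ʳ rewrite lookup-pairSet b | ⌊≟⌋-refl b = ∨-zeroʳ ⌊ b ≟ a ⌋

  pairSet-∌ : ∀ {e} → e ≢ a → e ≢ b → lookup (pairSet Γ a b) e ≡ false
  pairSet-∌ {e} e≢a e≢b rewrite lookup-pairSet e | ⌊≟⌋-≢ e≢a | ⌊≟⌋-≢ e≢b = refl

  pairSet-removeʳ : a ≢ b → ∀ e → lookup (pairSet Γ a b [ b ]≔ false) e ≡ ⌊ e ≟ a ⌋
  pairSet-removeʳ a≢b e with e ≟ b
  ... | yes refl rewrite lookup∘update e (pairSet Γ a b) false = sym (⌊≟⌋-≢ (a≢b ∘ sym))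
  ... | no e≢b rewrite lookup∘update′ e≢b (pairSet Γ a b) false | lookup-pairSet e | ⌊≟⌋-≢ e≢b =
    ∨-identityʳ ⌊ e ≟ a ⌋

  pairSet-removeˡ : a ≢ b → ∀ e → lookup (pairSet Γ a b [ a ]≔ false) e ≡ ⌊ e ≟ b ⌋
  pairSet-removeˡ a≢b e with e ≟ a
  ... | yes refl rewrite lookup∘update e (pairSet Γ a b) false = sym (⌊≟⌋-≢ a≢b)
  ... | no e≢a rewrite lookup∘update′ e≢a (pairSet Γ a b) false | lookup-pairSet e | ⌊≟⌋-≢ e≢a = refl

record ParallelPair (Γ : Graph) (v₀ : Fin (nV Γ)) : Set where
  field
    a b           : Fin (nE Γ)
    s t           : Fin (nV Γ)
    a≢b           : a ≢ b
    s≢t           : s ≢ t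
    a-ends        : Ends Γ a s t
    b-ends        : Ends Γ b s t
    D             : Vec ℤ (nV Γ)
    X-quasistable : Quasistable Γ v₀ (pd (pairSet Γ a b) D)

-- Positions in the list R Γ a b s t D = X , A s , A t , B s , B t , C s s , C s t , C t t.
pattern ∈X   = here refl
pattern ∈As  = there (here refl)
pattern ∈At  = there (there (here refl))
pattern ∈Bs  = there (there (there (here refl)))
pattern ∈Bt  = there (there (there (there (here refl))))
pattern ∈Css = there (there (there (there (there (here refl)))))
pattern ∈Cst = there (there (there (there (there (there (here refl))))))
pattern ∈Ctt = there (there (there (there (there (there (there (here refl)))))))
pattern ∉𝓡 p = there (there (there (there (there (there (there (there p)))))))

module ParallelPairProperties {Γ : Graph} {v₀ : Fin (nV Γ)} (P : ParallelPair Γ v₀) where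

  open ParallelPair P public

  X : PD Γ
  X = pd (pairSet Γ a b) D

  A B : Fin (nV Γ) → PD Γ
  A u = X -[ b ]+ u
  B u = X -[ a ]+ u

  C : Fin (nV Γ) → Fin (nV Γ) → PD Γ
  C u v = B u -[ b ]+ v

  Y : Fin (nE Γ) → PD Γ
  Y c = pd (pairSet Γ a c) D

  𝓡 : List (PD Γ)
  𝓡 = R Γ a b s t D

  Aₛ Aₜ Bₜ : PD Γ
  Aₛ = A s
  Aₜ = A t
  Bₜ = B t

  s∈a : Inc Γ s a
  s∈a = Ends⇒Inc {Γ} a-ends (inj₁ refl)

  t∈a : Inc Γ t a
  t∈a = Ends⇒Inc {Γ} a-ends (inj₂ refl)

  s∈b : Inc Γ s b
  s∈b = Ends⇒Inc {Γ} b-ends (inj₁ refl)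

  t∈b : Inc Γ t b
  t∈b = Ends⇒Inc {Γ} b-ends (inj₂ refl)

  X∋a : lookup (Ex X) a ≡ true
  X∋a = pairSet-∋ˡ Γ a b

  X∋b : lookup (Ex X) b ≡ true
  X∋b = pairSet-∋ʳ Γ a b

  ℰᴬ ℰᴮ ℰᶜ : Vec Bool (nE Γ)
  ℰᴬ = Ex (A s)
  ℰᴮ = Ex (B s)
  ℰᶜ = Ex (C s s)

  lookup-ℰᴬ : ∀ e → lookup ℰᴬ e ≡ ⌊ e ≟ a ⌋
  lookup-ℰᴬ = pairSet-removeʳ Γ a b a≢b

  lookup-ℰᴮ : ∀ e → lookup ℰᴮ e ≡ ⌊ e ≟ b ⌋
  lookup-ℰᴮ = pairSet-removeˡ Γ a b a≢b

  ℰᴬ∋a : lookup ℰᴬ a ≡ true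
  ℰᴬ∋a = trans (lookup-ℰᴬ a) (⌊≟⌋-refl a)

  ℰᴬ∌b : lookup ℰᴬ b ≡ false
  ℰᴬ∌b = trans (lookup-ℰᴬ b) (⌊≟⌋-≢ (a≢b ∘ sym))

  ℰᴮ∌a : lookup ℰᴮ a ≡ false
  ℰᴮ∌a = trans (lookup-ℰᴮ a) (⌊≟⌋-≢ a≢b)

  ℰᴮ∋b : lookup ℰᴮ b ≡ true
  ℰᴮ∋b = trans (lookup-ℰᴮ b) (⌊≟⌋-refl b)

  ℰᶜ∌a : lookup ℰᶜ a ≡ false
  ℰᶜ∌a = trans (lookup∘update′ a≢b ℰᴮ false) ℰᴮ∌a

  Y∌b : ∀ {c} → c ≢ b → lookup (Ex (Y c)) b ≡ false
  Y∌b {c} c≢b = pairSet-∌ Γ a c (a≢b ∘ sym) (c≢b ∘ sym)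

  A-quasistable : ∀ {u} → Inc Γ u b → Quasistable Γ v₀ (A u)
  A-quasistable u∈b = quasistable-specialise X X∋b u∈b X-quasistable

  B-quasistable : ∀ {u} → Inc Γ u a → Quasistable Γ v₀ (B u)
  B-quasistable u∈a = quasistable-specialise X X∋a u∈a X-quasistable

  C-quasistable : ∀ {u v} → Inc Γ u a → Inc Γ v b → Quasistable Γ v₀ (C u v)
  C-quasistable {u} u∈a v∈b = quasistable-specialise (B u) ℰᴮ∋b v∈b (B-quasistable u∈a)

  Y-quasistable : ∀ {c} → c ≢ a → c ≢ b → Ends Γ c s t → Quasistable Γ v₀ (Y c)
  Y-quasistable {c} c≢a c≢b c-ends =
    quasistable-permute (transpose b c) (transpose-SameEnds b-ends c-ends) {pairSet Γ a b} {pairSet Γ a c} {D}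
      Y≗X∘τ X-quasistable
    where
    Y≗X∘τ : ∀ i → lookup (pairSet Γ a c) i ≡ lookup (pairSet Γ a b) (PC.transpose b c i)
    Y≗X∘τ = transpose-elim {P = λ k l → lookup (pairSet Γ a c) k ≡ lookup (pairSet Γ a b) l} {b} {c}
      (trans (pairSet-∌ Γ a c (a≢b ∘ sym) (c≢b ∘ sym)) (sym (pairSet-∌ Γ a b c≢a c≢b)))
      (trans (pairSet-∋ʳ Γ a c) (sym (pairSet-∋ʳ Γ a b)))
      (λ k k≢b k≢c → trans (lookup-pairSet Γ a c k)
                             (trans (cong (⌊ k ≟ a ⌋ ∨_) (trans (⌊≟⌋-≢ k≢c) (sym (⌊≟⌋-≢ k≢b))))
                                    (sym (lookup-pairSet Γ a b k))))

  X⊒A : ∀ {u} → Inc Γ u b → X ⊒ A u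
  X⊒A u∈b = ⊒-specialise X∋b u∈b (λ _ → refl)

  A⊒C : ∀ {u v} → Inc Γ v a → A u ⊒ C u v
  A⊒C v∈a = ⊒-specialise ℰᴬ∋a v∈a (λ e → cong (λ V → lookup V e) ([]≔-commutes (pairSet Γ a b) a b a≢b))

  Y⊒A : ∀ {c u} → c ≢ a → Inc Γ u c → Y c ⊒ A u
  Y⊒A {c} c≢a u∈c =
    ⊒-specialise (pairSet-∋ʳ Γ a c) u∈c (λ e → trans (lookup-ℰᴬ e) (sym (pairSet-removeʳ Γ a c (c≢a ∘ sym) e)))

  ⊒B⇒⊒A : ∀ {Z u} → Z ⊒ B u → lookup (Ex Z) a ≡ true → Z ⊒ A u
  ⊒B⇒⊒A {Z} {u} Z⊒B Z∋a = ⊒-permute (transpose a b) (transpose-SameEnds a-ends b-ends) Z∘τ≗Z A≗B∘τ Z⊒B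
    where
    Z∋b : lookup (Ex Z) b ≡ true
    Z∋b = ⊒⇒⊇ Z⊒B ℰᴮ∋b

    Z∘τ≗Z : ∀ i → lookup (Ex Z) (PC.transpose a b i) ≡ lookup (Ex Z) i
    Z∘τ≗Z = transpose-elim {P = λ k l → lookup (Ex Z) l ≡ lookup (Ex Z) k}
      (trans Z∋b (sym Z∋a)) (trans Z∋a (sym Z∋b)) (λ _ _ _ → refl)

    A≗B∘τ : ∀ i → lookup ℰᴬ i ≡ lookup ℰᴮ (PC.transpose a b i)
    A≗B∘τ = transpose-elim {P = λ k l → lookup ℰᴬ k ≡ lookup ℰᴮ l}
      (trans ℰᴬ∋a (sym ℰᴮ∋b)) (trans ℰᴬ∌b (sym ℰᴮ∌a))
      (λ k k≢a k≢b → trans (lookup-ℰᴬ k) (trans (⌊≟⌋-≢ k≢a) (sym (trans (lookup-ℰᴮ k) (⌊≟⌋-≢ k≢b)))))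

  ⋡-raised : ∀ {x y : PD Γ} u → lookup (Dv x) u ≡ lookup D u + 1ℤ → lookup (Dv y) u ≡ lookup D u →
             ¬ (x ⊒ y)
  ⋡-raised u x-raised y-unraised =
    ⋡-level u (subst₂ _<_ (sym y-unraised) (sym x-raised) (i<i+1 (lookup D u)))

  Dv-C-elsewhere : ∀ {u v w} → w ≢ u → w ≢ v → lookup (Dv (C u v)) w ≡ lookup D w
  Dv-C-elsewhere {u} {v} {w} w≢u w≢v =
    trans (lookup∘updateAt′ w v w≢v (Dv (B u))) (lookup∘updateAt′ w u w≢u D)

  As⋡At : ¬ (A s ⊒ A t)
  As⋡At = ⋡-raised s (lookup∘updateAt s D) (lookup∘updateAt′ s t s≢t D)

  At⋡As : ¬ (A t ⊒ A s)
  At⋡As = ⋡-raised t (lookup∘updateAt t D) (lookup∘updateAt′ t s (s≢t ∘ sym) D)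

  As⋡Ctt : ¬ (A s ⊒ C t t)
  As⋡Ctt = ⋡-raised s (lookup∘updateAt s D) (Dv-C-elsewhere s≢t s≢t)

  Bs⋡Bt : ¬ (B s ⊒ B t)
  Bs⋡Bt = ⋡-raised s (lookup∘updateAt s D) (lookup∘updateAt′ s t s≢t D)

  Bs⋡Ctt : ¬ (B s ⊒ C t t)
  Bs⋡Ctt = ⋡-raised s (lookup∘updateAt s D) (Dv-C-elsewhere s≢t s≢t)

  Bt⋡At : ¬ (B t ⊒ A t)
  Bt⋡At = ⋡-edge ℰᴬ∋a ℰᴮ∌a

  Ctt⋡At : ¬ (C t t ⊒ A t)
  Ctt⋡At = ⋡-edge ℰᴬ∋a ℰᶜ∌a

open ParallelPairProperties using (𝓡; Aₛ; Aₜ; Bₜ)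

module Correspondence
  {Γ Γ′ : Graph} {v₀ : Fin (nV Γ)} {v₀′ : Fin (nV Γ′)} (f : PosetIso Γ v₀ Γ′ v₀′)
  (P : ParallelPair Γ v₀) (P′ : ParallelPair Γ′ v₀′)
  (image : ImageEq f (𝓡 P) (𝓡 P′))
  (As↦A′s : MapsTo f (Aₛ P) (Aₛ P′)) (At↦B′t : MapsTo f (Aₜ P) (Bₜ P′))
  where

  private
    module K = ParallelPairProperties P
    module K′ = ParallelPairProperties P′

  open K using (a; b; s; t; X; A; B; Y)
  open K′ using () renaming (a to a′; b to b′; s to s′; t to t′; A to A′; B to B′; C to C′; Y to Y′)

  private
    F : PD Γ → PD Γ′
    F = fun f

    ⊒-preserved : ∀ {x y} → Quasistable Γ v₀ x → Quasistable Γ v₀ y → x ⊒ y → F x ⊒ F y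
    ⊒-preserved {x} {y} qx qy ⟨ x≽y ⟩ = ⟨ proj₁ (mono f x y qx qy) x≽y ⟩

    ⊒-reflected : ∀ {x y} → Quasistable Γ v₀ x → Quasistable Γ v₀ y → F x ⊒ F y → x ⊒ y
    ⊒-reflected {x} {y} qx qy ⟨ Fx≽Fy ⟩ = ⟨ proj₂ (mono f x y qx qy) Fx≽Fy ⟩

    qAs : Quasistable Γ v₀ (A s)
    qAs = proj₁ As↦A′s

    FAs : F (A s) ≡ A′ s′
    FAs = proj₂ As↦A′s

    qAt : Quasistable Γ v₀ (A t)
    qAt = proj₁ At↦B′t

    FAt : F (A t) ≡ B′ t′
    FAt = proj₂ At↦B′t

    qA′t : Quasistable Γ′ v₀′ (A′ t′)
    qA′t = K′.A-quasistable K′.t∈b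

    qC′tt : Quasistable Γ′ v₀′ (C′ t′ t′)
    qC′tt = K′.C-quasistable K′.t∈a K′.t∈b

  data A′t-Preimage : PD Γ → Set where
    via-X  : A′t-Preimage X
    via-Bs : A′t-Preimage (B s)
    via-Bt : A′t-Preimage (B t)

  A′t-preimage : ∀ {W} → W ∈ K.𝓡 → Quasistable Γ v₀ W → F W ≡ A′ t′ → A′t-Preimage W
  A′t-preimage ∈X   _  _     = via-X
  A′t-preimage ∈As  _  FW≡   = ⊥-elim (K′.As⋡At (≡⇒⊒ (trans (sym FAs) FW≡)))
  A′t-preimage ∈At  _  FW≡   = ⊥-elim (K′.Bt⋡At (≡⇒⊒ (trans (sym FAt) FW≡)))
  A′t-preimage ∈Bs  _  _     = via-Bs
  A′t-preimage ∈Bt  _  _     = via-Bt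
  A′t-preimage ∈Css qW FW≡   = ⊥-elim (K′.As⋡At (subst₂ _⊒_ FAs FW≡ (⊒-preserved qAs qW (K.A⊒C K.s∈a))))
  A′t-preimage ∈Cst qW FW≡   = ⊥-elim (K′.As⋡At (subst₂ _⊒_ FAs FW≡ (⊒-preserved qAs qW (K.A⊒C K.t∈a))))
  A′t-preimage ∈Ctt qW FW≡   = ⊥-elim (K′.Bt⋡At (subst₂ _⊒_ FAt FW≡ (⊒-preserved qAt qW (K.A⊒C K.t∈a))))
  A′t-preimage (∉𝓡 ()) _ _

  A′t-preimage∋b : ∀ {W} → A′t-Preimage W → lookup (Ex W) b ≡ true
  A′t-preimage∋b via-X  = K.X∋b
  A′t-preimage∋b via-Bs = K.ℰᴮ∋b
  A′t-preimage∋b via-Bt = K.ℰᴮ∋b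

  no-third-edge : ∀ {c} → c ≢ a → c ≢ b → Ends Γ c s t → ⊥
  no-third-edge {c} c≢a c≢b c-ends with proj₂ image (A′ t′) ∈At qA′t
  ... | W , W∈𝓡 , qW , FW≡A′t =
    not-¬ (K.Y∌b c≢b) (⊒⇒⊇ Yc⊒W (A′t-preimage∋b (A′t-preimage W∈𝓡 qW FW≡A′t)))
    where
    qY : Quasistable Γ v₀ (Y c)
    qY = K.Y-quasistable c≢a c≢b c-ends

    FY⊒A′s : F (Y c) ⊒ A′ s′
    FY⊒A′s = subst (F (Y c) ⊒_) FAs (⊒-preserved qY qAs (K.Y⊒A c≢a (Ends⇒Inc {Γ} c-ends (inj₁ refl))))

    FY⊒B′t : F (Y c) ⊒ B′ t′
    FY⊒B′t = subst (F (Y c) ⊒_) FAt (⊒-preserved qY qAt (K.Y⊒A c≢a (Ends⇒Inc {Γ} c-ends (inj₂ refl))))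

    Yc⊒W : Y c ⊒ W
    Yc⊒W = ⊒-reflected qY qW
             (subst (F (Y c) ⊒_) (sym FW≡A′t) (K′.⊒B⇒⊒A FY⊒B′t (⊒⇒⊇ FY⊒A′s K′.ℰᴬ∋a)))

  Bs↛A′t : Quasistable Γ v₀ (B s) → F (B s) ≢ A′ t′
  Bs↛A′t qBs FBs≡A′t with proj₂ image (C′ t′ t′) ∈Ctt qC′tt
  ... | V , V∈𝓡 , qV , FV≡C′tt =
    excluded V∈𝓡 qV FV≡C′tt
      (⊒-reflected qBs qV (subst₂ _⊒_ (sym FBs≡A′t) (sym FV≡C′tt) (K′.A⊒C K′.t∈a)))
    where
    excluded : ∀ {V} → V ∈ K.𝓡 → Quasistable Γ v₀ V → F V ≡ C′ t′ t′ → ¬ (B s ⊒ V)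
    excluded ∈X   _  _    = ⋡-edge K.X∋a K.ℰᴮ∌a
    excluded ∈As  _  _    = ⋡-edge K.ℰᴬ∋a K.ℰᴮ∌a
    excluded ∈At  _  _    = ⋡-edge K.ℰᴬ∋a K.ℰᴮ∌a
    excluded ∈Bs  _  FV≡  = λ _ → K′.Ctt⋡At (≡⇒⊒ (trans (sym FV≡) FBs≡A′t))
    excluded ∈Bt  _  _    = K.Bs⋡Bt
    excluded ∈Css qV FV≡  = λ _ → K′.As⋡Ctt (subst₂ _⊒_ FAs FV≡ (⊒-preserved qAs qV (K.A⊒C K.s∈a)))
    excluded ∈Cst qV FV≡  = λ _ → K′.As⋡Ctt (subst₂ _⊒_ FAs FV≡ (⊒-preserved qAs qV (K.A⊒C K.t∈a)))
    excluded ∈Ctt _  _    = K.Bs⋡Ctt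
    excluded (∉𝓡 ()) _ _

  no-third-edge′ : ∀ {c′} → c′ ≢ a′ → c′ ≢ b′ → Ends Γ′ c′ s′ t′ → ⊥
  no-third-edge′ {c′} c′≢a′ c′≢b′ c′-ends with proj₂ image (A′ t′) ∈At qA′t
  ... | W , W∈𝓡 , qW , FW≡A′t = via (A′t-preimage W∈𝓡 qW FW≡A′t) qW FW≡A′t
    where
    qY′ : Quasistable Γ′ v₀′ (Y′ c′)
    qY′ = K′.Y-quasistable c′≢a′ c′≢b′ c′-ends

    Z : PD Γ
    Z = inv f (Y′ c′)

    qZ : Quasistable Γ v₀ Z
    qZ = inv-QD f (Y′ c′) qY′

    FZ≡Y′ : F Z ≡ Y′ c′
    FZ≡Y′ = fun-inv f (Y′ c′) qY′

    Z⊒As : Z ⊒ A s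
    Z⊒As = ⊒-reflected qZ qAs
             (subst₂ _⊒_ (sym FZ≡Y′) (sym FAs) (K′.Y⊒A c′≢a′ (Ends⇒Inc {Γ′} c′-ends (inj₁ refl))))

    via : ∀ {W} → A′t-Preimage W → Quasistable Γ v₀ W → F W ≡ A′ t′ → ⊥
    via via-X  qX  FX≡A′t  = K′.At⋡As (subst₂ _⊒_ FX≡A′t FAs (⊒-preserved qX qAs (K.X⊒A K.s∈b)))
    via via-Bs qBs FBs≡A′t = Bs↛A′t qBs FBs≡A′t
    via via-Bt qBt FBt≡A′t = not-¬ (K′.Y∌b c′≢b′) (⊒⇒⊇ Y′⊒B′t K′.ℰᴮ∋b)
      where
      Z⊒Bt : Z ⊒ B t
      Z⊒Bt = ⊒-reflected qZ qBt
               (subst₂ _⊒_ (sym FZ≡Y′) (sym FBt≡A′t) (K′.Y⊒A c′≢a′ (Ends⇒Inc {Γ′} c′-ends (inj₂ refl))))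

      Y′⊒B′t : Y′ c′ ⊒ B′ t′
      Y′⊒B′t = subst₂ _⊒_ FZ≡Y′ FAt (⊒-preserved qZ qAt (K.⊒B⇒⊒A Z⊒Bt (⊒⇒⊇ Z⊒As K.ℰᴬ∋a)))

specialPair : ∀ {Γ v₀} (P : ParallelPair Γ v₀) (let open ParallelPair P) → Parallel Γ a b →
              (∀ {c} → c ≢ a → c ≢ b → Ends Γ c s t → ⊥) → SpecialPair Γ a b
specialPair {Γ} P par no-third =
  a≢b , par , (λ e e≢a e≢b → not-parallel-to a-ends e≢a e≢b , not-parallel-to b-ends e≢a e≢b) ,
  λ u w → Reach-mono outside-pair (quasistable⇒complement-connected X X-quasistable u w)
  where
  open ParallelPairProperties P

  not-parallel-to : ∀ {e c} → Ends Γ c s t → e ≢ a → e ≢ b → ¬ Parallel Γ e c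
  not-parallel-to c-ends e≢a e≢b = no-third e≢a e≢b ∘ Parallel⇒Ends {Γ} s≢t c-ends

  outside-pair : ∀ e → lookup (pairSet Γ a b) e ≡ false → e ≢ a × e ≢ b
  outside-pair e e∉ = (λ { refl → not-¬ e∉ X∋a }) , (λ { refl → not-¬ e∉ X∋b })

lemma5p5 : (Γ Γ' : Graph) → Connected Γ → Connected Γ' →
    (v₀ : Fin (nV Γ)) (v₀' : Fin (nV Γ')) (f : PosetIso Γ v₀ Γ' v₀') →
    (e₁ e₂ : Fin (nE Γ)) (s t : Fin (nV Γ)) →
    e₁ ≢ e₂ → Parallel Γ e₁ e₂ → Ends Γ e₁ s t → Ends Γ e₂ s t →
    (D : Vec ℤ (nV Γ)) → Quasistable Γ v₀ (pd (pairSet Γ e₁ e₂) D) →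
    (e₁' e₂' : Fin (nE Γ')) (s' t' : Fin (nV Γ')) →
    e₁' ≢ e₂' → Parallel Γ' e₁' e₂' → Ends Γ' e₁' s' t' → Ends Γ' e₂' s' t' →
    (D' : Vec ℤ (nV Γ')) → Quasistable Γ' v₀' (pd (pairSet Γ' e₁' e₂') D') →
    ImageEq f (R Γ e₁ e₂ s t D) (R Γ' e₁' e₂' s' t' D') →
    MapsTo f (_-v[_]+_ Γ (pd (pairSet Γ e₁ e₂) D) e₂ s)
             (_-v[_]+_ Γ' (pd (pairSet Γ' e₁' e₂') D') e₂' s') →
    MapsTo f (_-v[_]+_ Γ (pd (pairSet Γ e₁ e₂) D) e₂ t)
             (_-v[_]+_ Γ' (pd (pairSet Γ' e₁' e₂') D') e₁' t') →
    SpecialPair Γ e₁ e₂ × SpecialPair Γ' e₁' e₂'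
lemma5p5 Γ Γ' _ _ v₀ v₀' f e₁ e₂ s t e₁≢e₂ par e₁-ends e₂-ends D qX
         e₁' e₂' s' t' e₁'≢e₂' par' e₁'-ends e₂'-ends D' qX' image As↦A's At↦B't =
  specialPair P par no-third-edge , specialPair P' par' no-third-edge′
  where
  P : ParallelPair Γ v₀
  P = record { a = e₁ ; b = e₂ ; s = s ; t = t ; a≢b = e₁≢e₂
             ; s≢t = Parallel⇒distinct-ends {Γ} e₁-ends par
             ; a-ends = e₁-ends ; b-ends = e₂-ends ; D = D ; X-quasistable = qX }

  P' : ParallelPair Γ' v₀'
  P' = record { a = e₁' ; b = e₂' ; s = s' ; t = t' ; a≢b = e₁'≢e₂'
              ; s≢t = Parallel⇒distinct-ends {Γ'} e₁'-ends par'
              ; a-ends = e₁'-ends ; b-ends = e₂'-ends ; D = D' ; X-quasistable = qX' }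

  open Correspondence f P P' image As↦A's At↦B't
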